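{- Suppose $k>p$ and let $i=k-p$. Let $X=\{x_1,\dots,x_i\}$, $Y=\{y_1,\dots,y_i\}$ and $\Delta=\{y_{i+1},\dots,y_{k-1}\}$ be pairwise disjoint subsets of $\{1,\dots,2k-3\}$ (with the indicated elements distinct). For $\tau\subseteq\{1,\dots,i\}$ let $X_\tau=\{x_j:j\in\tau\}$ and $Y_\tau=\{y_j:j\in\tau\}$. Define $\vec v_i(X,Y,\Delta)\in\mathbb{F}_q^{\binom{2k-3}{k-1}}$, with coordinates indexed by the $(k-1)$-subsets $C$ of $\{1,\dots,2k-3\}$, by $\vec v_i(X,Y,\Delta)_C=(-1)^{|\tau|}$ if $C=X_\tau\cup(Y\setminus Y_\tau)\cup\Delta$ for some $\tau\subseteq\{1,\dots,i\}$, and $0$ otherwise. Then $\vec v_{k-p}(X,Y,\Delta)$ lies in the column space over $\mathbb{F}_q$ of the inclusion matrix $I_{2k-3}(k-1,k-2)$.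
   Context: $\mathbb{F}_q$ is a finite field of order $q$ and characteristic $p$. The inclusion matrix $I_r(a,b)$ has rows indexed by the $a$-subsets of $\{1,\dots,r\}$, columns indexed by the $b$-subsets of $\{1,\dots,r\}$, and $(A,B)$-entry $1$ if $B\subset A$ and $0$ otherwise; it is regarded as a matrix over $\mathbb{F}_q$. -}

module Defs where

open import Level using (_⊔_)
open import Algebra.Bundles using (CommutativeRing)
open import Data.Nat using (ℕ; zero; suc; _<_)
open import Data.Bool using (Bool; true; false; _≟_)
open import Data.Fin using (Fin)
open import Data.Fin.Subset using (Subset; ⋃; ⁅_⁆; _∪_; _─_; ⊤; ∣_∣; inside; outside)
open import Data.Fin.Subset.Properties using (_∈?_; _⊆?_)
open import Data.List using (List; []; _∷_; map; filter; allFin; foldr; _++_)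
open import Data.Vec using (Vec; []; _∷_)
open import Data.Vec.Properties using (≡-dec)
open import Data.Maybe using (Maybe; just; nothing)
open import Data.Product using (Σ; ∃; _×_)
open import Relation.Nullary using (¬_; yes; no)
open import Relation.Binary.PropositionalEquality using (_≡_)

allSubsets : (n : ℕ) → List (Subset n)
allSubsets zero = [] ∷ []
allSubsets (suc n) = map (outside ∷_) (allSubsets n) ++ map (inside ∷_) (allSubsets n)

image : ∀ {m n} → (Fin m → Fin n) → Subset m → Subset n
image {m} f S = ⋃ (map (λ j → ⁅ f j ⁆) (filter (λ j → j ∈? S) (allFin m)))

module _ {c ℓ} (F : CommutativeRing c ℓ) where
  open CommutativeRing F

  _·1 : ℕ → Carrier
  zero ·1 = 0#
  suc m ·1 = 1# + (m ·1)

  signPow : ℕ → Carrier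
  signPow zero = 1#
  signPow (suc m) = (- 1#) * signPow m

  IsField : Set (c ⊔ ℓ)
  IsField = (¬ (1# ≈ 0#)) × (∀ a → ¬ (a ≈ 0#) → ∃ λ b → (a * b) ≈ 1#)

  IsFinite : Set (c ⊔ ℓ)
  IsFinite = Σ ℕ λ q → Σ (Fin q → Carrier) λ e → ∀ a → ∃ λ j → e j ≈ a

  HasCharacteristic : ℕ → Set ℓ
  HasCharacteristic p =
    (p ·1 ≈ 0#) × (∀ m → 0 < m → m < p → ¬ ((m ·1) ≈ 0#))

  sumF : List Carrier → Carrier
  sumF = foldr _+_ 0#

  inclEntry : ∀ {n} → Subset n → Subset n → Carrier
  inclEntry A B with B ⊆? A
  ... | yes _ = 1#
  ... | no _ = 0#

  subsetsOfSize : (n b : ℕ) → List (Subset n)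
  subsetsOfSize n b = filter (λ B → Data.Nat._≟_ ∣ B ∣ b) (allSubsets n)

  InColumnSpace : (n a b : ℕ) → (Subset n → Carrier) → Set (c ⊔ ℓ)
  InColumnSpace n a b v =
    ∃ λ (w : Subset n → Carrier) → ∀ (C : Subset n) → ∣ C ∣ ≡ a →
      v C ≈ sumF (map (λ B → inclEntry C B * w B) (subsetsOfSize n b))

  Cset : ∀ {i d n} → (Fin i → Fin n) → (Fin i → Fin n) → (Fin d → Fin n) →
         Subset i → Subset n
  Cset x y δ τ = (image x τ ∪ (image y ⊤ ─ image y τ)) ∪ image δ ⊤

  findτ : ∀ {i d n} → (Fin i → Fin n) → (Fin i → Fin n) → (Fin d → Fin n) →
          Subset n → List (Subset i) → Maybe (Subset i)
  findτ x y δ C [] = nothing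
  findτ x y δ C (τ ∷ τs) with ≡-dec _≟_ C (Cset x y δ τ)
  ... | yes _ = just τ
  ... | no _ = findτ x y δ C τs

  vVec : ∀ {i d n} → (Fin i → Fin n) → (Fin i → Fin n) → (Fin d → Fin n) →
         Subset n → Carrier
  vVec {i} x y δ C with findτ x y δ C (allSubsets i)
  ... | just τ = signPow ∣ τ ∣
  ... | nothing = 0#

module Submission where

-- Let n = 2k - 3, i = k - p = |X| = |Y|, d = (k - 1) - i = p - 1 = |Δ|, R the complement of
-- X ∪ Y ∪ Δ (so |R| = d - 1), and a(J) = (J + 1)⁻¹ for J < d.  Call a set balanced if it
-- contains exactly one of x_j, y_j for each j.  The preimage is w(B) = (-1)^{|B∩X|} a(|B∩Δ|)
-- for balanced B and 0 otherwise, and the C-entry of I w is the sum of w over the facets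
-- C ∖ {t}, t ∈ C.  If C is unbalanced at j, no facet is balanced, or only C ∖ {x_j} and
-- C ∖ {y_j} are and their weights cancel.  If C is balanced, with J = |C ∩ Δ|, r = |C ∩ R|,
-- J + r = d, the entry is (-1)^{|C∩X|} (J a(J-1) + r a(J)): for r = 0 the set C is
-- X_τ ∪ (Y ∖ Y_τ) ∪ Δ and the entry is v_C = (-1)^{|τ|}; for r > 0 it is a multiple of
-- (J + r + 1) = p = 0 = v_C.

open import Algebra.Bundles using (CommutativeMonoid; CommutativeRing)
open import Data.Bool using (Bool; true; false; if_then_else_; not; _∧_; _∨_)
open import Data.Bool.Properties
  using (not-injective; not-involutive; ¬-not; not-¬; ∨-identityʳ; ∨-zeroʳ; ∧-identityʳ)
  renaming (_≟_ to _≟ᵇ_)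
open import Data.Fin using (Fin; zero; suc; punchIn; punchOut)
open import Data.Fin.Properties
  using (punchInᵢ≢i; punchIn-injective; punchIn-punchOut; any?; all?; ¬∀⟶∃¬)
  renaming (_≟_ to _≟ᶠ_)
open import Data.Fin.Subset using (Subset; ∣_∣; inside; outside; _∪_; _─_; ⁅_⁆; ⋃; ⊤)
open import Data.Fin.Subset.Properties using (_∈?_; _⊆?_; p⊆q⇒∣p∣≤∣q∣)
open import Data.List using (List; []; _∷_; _++_; map; filter; allFin)
open import Data.List.Membership.Propositional using (_∈_; find; lose)
open import Data.List.Membership.Propositional.Properties
  using (∈-filter⁺; ∈-filter⁻; ∈-allFin; ∈-map⁺; ∈-++⁺ˡ; ∈-++⁺ʳ)
open import Data.List.Relation.Unary.Any using (Any; here; there)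
import Data.List.Relation.Unary.Any.Properties as AnyP
open import Data.Maybe using (just; nothing)
open import Data.Maybe.Properties using (just-injective)
open import Data.Nat as ℕ using (ℕ; zero; suc; _≤_; _<_; _∸_; z≤n; s≤s)
import Data.Nat.Properties as ℕP
open import Data.Nat.Tactic.RingSolver using (solve-∀)
open import Data.Product using (∃; _×_; _,_; proj₁; proj₂)
open import Data.Vec using ([]; _∷_; lookup; tabulate)
import Data.Vec.Properties as VecP
open import Function using (_∘_)
open import Function.Definitions using (Injective)
open import Relation.Binary.PropositionalEquality as ≡ using (_≡_; _≢_)
open import Relation.Nullary using (¬_; Dec; does; yes; no; contradiction)
open import Relation.Nullary.Decidable using (dec-true; dec-false)

open import Defs using (image; allSubsets; sumF; inclEntry; subsetsOfSize; _·1; signPow; Cset; findτ;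
  vVec; InColumnSpace; IsField; IsFinite; HasCharacteristic)

module MonoidSums {a ℓ} (M : CommutativeMonoid a ℓ) where

  open CommutativeMonoid M renaming (_∙_ to _+_; ε to 0#; ∙-congˡ to +-congˡ;
    ∙-cong to +-cong; identityʳ to +-identityʳ)
  open import Algebra.Properties.CommutativeMonoid.Sum M public
  open import Relation.Binary.Reasoning.Setoid setoid

  sum-zero : ∀ {n} {f : Fin n → Carrier} → (∀ t → f t ≈ 0#) → sum f ≈ 0#
  sum-zero {n} f≈0 = trans (sum-cong-≋ f≈0) (sum-replicate-zero n)

  sum-point : ∀ {n} (f : Fin n → Carrier) (a : Fin n) →
              (∀ t → t ≢ a → f t ≈ 0#) → sum f ≈ f a
  sum-point {suc n} f a f≈0 = begin
    sum f                         ≈⟨ sum-remove f ⟩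
    f a + sum (λ t → f (punchIn a t)) ≈⟨ +-congˡ (sum-zero (λ t → f≈0 _ (punchInᵢ≢i a t))) ⟩
    f a + 0#                      ≈⟨ +-identityʳ (f a) ⟩
    f a                           ∎

  sum-pair : ∀ {n} (f : Fin n → Carrier) {a b : Fin n} (a≢b : a ≢ b) →
             (∀ t → t ≢ a → t ≢ b → f t ≈ 0#) → sum f ≈ f a + f b
  sum-pair {suc n} f {a} {b} a≢b f≈0 = begin
    sum f                              ≈⟨ sum-remove f ⟩
    f a + sum (f ∘ punchIn a)          ≈⟨ +-congˡ (sum-point (f ∘ punchIn a) b′ off-b) ⟩
    f a + f (punchIn a b′)             ≡⟨ ≡.cong (λ t → f a + f t) (punchIn-punchOut a≢b) ⟩
    f a + f b                          ∎
    where
    b′ : Fin n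
    b′ = punchOut a≢b
    off-b : ∀ t → t ≢ b′ → f (punchIn a t) ≈ 0#
    off-b t t≢b′ = f≈0 _ (punchInᵢ≢i a t) λ eq →
      t≢b′ (punchIn-injective a t b′ (≡.trans eq (≡.sym (punchIn-punchOut a≢b))))

  sum-delta : ∀ {n} (a : Fin n) (f : Fin n → Carrier) →
              ∑[ t < n ] (if does (a ≟ᶠ t) then f t else 0#) ≈ f a
  sum-delta a f = trans (sum-point _ a off-a) (reflexive (≡.cong (λ b → if b then f a else 0#)
                                                           (dec-true (a ≟ᶠ a) ≡.refl)))
    where
    off-a : ∀ t → t ≢ a → (if does (a ≟ᶠ t) then f t else 0#) ≈ 0#
    off-a t t≢a = reflexive (≡.cong (λ b → if b then f t else 0#)
                                    (dec-false (a ≟ᶠ t) (t≢a ∘ ≡.sym)))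

  fibre : ∀ {m n} → (Fin m → Fin n) → Fin n → Carrier → Carrier
  fibre {m} g t c = ∑[ j < m ] (if does (g j ≟ᶠ t) then c else 0#)

  sum-fibres : ∀ {m n} (g : Fin m → Fin n) (f : Fin n → Carrier) →
               ∑[ t < n ] fibre g t (f t) ≈ ∑[ j < m ] f (g j)
  sum-fibres {m} {n} g f = begin
    ∑[ t < n ] ∑[ j < m ] (if does (g j ≟ᶠ t) then f t else 0#)
      ≈⟨ ∑-comm (λ t j → if does (g j ≟ᶠ t) then f t else 0#) ⟩
    ∑[ j < m ] ∑[ t < n ] (if does (g j ≟ᶠ t) then f t else 0#)
      ≈⟨ sum-cong-≋ (λ j → sum-delta (g j) f) ⟩
    ∑[ j < m ] f (g j) ∎

  fibre-hit : ∀ {m n} (g : Fin m → Fin n) → Injective _≡_ _≡_ g →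
              ∀ {j t} c → g j ≡ t → fibre g t c ≈ c
  fibre-hit g g-inj {j} {t} c ≡.refl = trans (sum-point _ j off-j) (reflexive (≡.cong (λ b → if b then c else 0#)
                                                                (dec-true (g j ≟ᶠ g j) ≡.refl)))
    where
    off-j : ∀ j′ → j′ ≢ j → (if does (g j′ ≟ᶠ g j) then c else 0#) ≈ 0#
    off-j j′ j′≢j = reflexive (≡.cong (λ b → if b then c else 0#) (dec-false (g j′ ≟ᶠ g j) (j′≢j ∘ g-inj)))

  fibre-miss : ∀ {m n} (g : Fin m → Fin n) {t} c → (∀ j → g j ≢ t) → fibre g t c ≈ 0#
  fibre-miss g {t} c miss = sum-zero λ j →
    reflexive (≡.cong (λ b → if b then c else 0#) (dec-false (g j ≟ᶠ t) (miss j)))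

module ℕ-Sums = MonoidSums ℕP.+-0-commutativeMonoid

ind : Bool → ℕ
ind true  = 1
ind false = 0

count : ∀ {m} → (Fin m → Bool) → ℕ
count b = ℕ-Sums.sum (ind ∘ b)

sum-ones : ∀ m → ℕ-Sums.∑[ j < m ] 1 ≡ m
sum-ones zero    = ≡.refl
sum-ones (suc m) = ≡.cong suc (sum-ones m)

count-cong : ∀ {m} {b b′ : Fin m → Bool} → (∀ j → b j ≡ b′ j) → count b ≡ count b′
count-cong b≗b′ = ℕ-Sums.sum-cong-≋ (≡.cong ind ∘ b≗b′)

∣∣-count : ∀ {n} (C : Subset n) → ∣ C ∣ ≡ count (lookup C)
∣∣-count []          = ≡.refl
∣∣-count (true ∷ C)  = ≡.cong suc (∣∣-count C)
∣∣-count (false ∷ C) = ∣∣-count C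

count-switch : ∀ {m} {b b′ : Fin m → Bool} (j : Fin m) → b j ≡ true → b′ j ≡ false →
               (∀ j′ → j′ ≢ j → b′ j′ ≡ b j′) → count b ≡ suc (count b′)
count-switch {suc m} {b} {b′} j bj b′j agree = begin
  count b                                      ≡⟨ ℕ-Sums.sum-remove (ind ∘ b) ⟩
  ind (b j) ℕ.+ count (b ∘ punchIn j)          ≡⟨ ≡.cong₂ ℕ._+_ (≡.cong ind bj) (count-cong same) ⟩
  suc (count (b′ ∘ punchIn j))                 ≡⟨ ≡.cong (λ c → suc (ind c ℕ.+ count (b′ ∘ punchIn j))) b′j ⟨
  suc (ind (b′ j) ℕ.+ count (b′ ∘ punchIn j))  ≡⟨ ≡.cong suc (ℕ-Sums.sum-remove (ind ∘ b′)) ⟨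
  suc (count b′)                               ∎
  where
  open ≡.≡-Reasoning
  same : ∀ t → (b ∘ punchIn j) t ≡ (b′ ∘ punchIn j) t
  same t = ≡.sym (agree _ (punchInᵢ≢i j t))

count-∧ : ∀ {m} (r b : Fin m → Bool) → count (λ j → r j ∧ b j) ≤ count r
count-∧ {zero}  r b = z≤n
count-∧ {suc m} r b with r zero
... | true  = ℕP.+-mono-≤ (ind≤1 (b zero)) (count-∧ (r ∘ suc) (b ∘ suc))
  where
  ind≤1 : ∀ c → ind c ≤ 1
  ind≤1 true  = s≤s z≤n
  ind≤1 false = z≤n
... | false = count-∧ (r ∘ suc) (b ∘ suc)

count≤ : ∀ {m} (b : Fin m → Bool) → count b ≤ m
count≤ {zero}  b = z≤n
count≤ {suc m} b with b zero
... | true  = s≤s (count≤ (b ∘ suc))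
... | false = ℕP.m≤n⇒m≤1+n (count≤ (b ∘ suc))

count≡0 : ∀ {m} (b : Fin m → Bool) → count b ≡ 0 → ∀ j → b j ≡ false
count≡0 b #b≡0 zero    with b zero
... | false = ≡.refl
count≡0 b #b≡0 (suc j) with b zero
... | false = count≡0 (b ∘ suc) #b≡0 j

count≡m : ∀ {m} (b : Fin m → Bool) → count b ≡ m → ∀ j → b j ≡ true
count≡m {suc m} b #b≡m zero    with b zero
... | true  = ≡.refl
... | false = contradiction (count≤ (b ∘ suc)) (ℕP.<⇒≱ (ℕP.≤-reflexive (≡.sym #b≡m)))
count≡m {suc m} b #b≡m (suc j) with b zero
... | true  = count≡m (b ∘ suc) (ℕP.suc-injective #b≡m) j
... | false = contradiction (count≤ (b ∘ suc)) (ℕP.<⇒≱ (ℕP.≤-reflexive (≡.sym #b≡m)))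

lookup-∪ : ∀ {n} (p q : Subset n) t → lookup (p ∪ q) t ≡ lookup p t ∨ lookup q t
lookup-∪ p q t = VecP.lookup-zipWith _∨_ t p q

lookup-─ : ∀ {n} (p q : Subset n) t → lookup (p ─ q) t ≡ not (lookup q t) ∧ lookup p t
lookup-─ (b ∷ p) (true ∷ q)  zero    = ≡.refl
lookup-─ (b ∷ p) (false ∷ q) zero    = ≡.refl
lookup-─ (b ∷ p) (c ∷ q)     (suc t) = lookup-─ p q t

lookup-⊤ : ∀ {n} (t : Fin n) → lookup ⊤ t ≡ true
lookup-⊤ t = VecP.lookup-replicate t true

lookup-⁅⁆ : ∀ {n} (a t : Fin n) → lookup ⁅ a ⁆ t ≡ does (a ≟ᶠ t)
lookup-⁅⁆ zero    zero    = ≡.refl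
lookup-⁅⁆ zero    (suc t) = VecP.lookup-replicate t false
lookup-⁅⁆ (suc a) zero    = ≡.refl
lookup-⁅⁆ (suc a) (suc t) = lookup-⁅⁆ a t

lookup-⋃⁻ : ∀ {n} (ps : List (Subset n)) t → lookup (⋃ ps) t ≡ true →
            Any (λ p → lookup p t ≡ true) ps
lookup-⋃⁻ []       t ⊥∋t = contradiction (≡.trans (≡.sym (VecP.lookup-replicate t false)) ⊥∋t) λ ()
lookup-⋃⁻ (p ∷ ps) t ∪∋t with lookup p t in p∋t
... | true  = here p∋t
... | false = there (lookup-⋃⁻ ps t
  (≡.trans (≡.cong (_∨ _) (≡.sym p∋t)) (≡.trans (≡.sym (lookup-∪ p (⋃ ps) t)) ∪∋t)))

lookup-⋃⁺ : ∀ {n} (ps : List (Subset n)) t → Any (λ p → lookup p t ≡ true) ps →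
            lookup (⋃ ps) t ≡ true
lookup-⋃⁺ (p ∷ ps) t (here p∋t)   = ≡.trans (lookup-∪ p (⋃ ps) t) (≡.cong (_∨ _) p∋t)
lookup-⋃⁺ (p ∷ ps) t (there ps∋t) = ≡.trans (lookup-∪ p (⋃ ps) t)
  (≡.trans (≡.cong (lookup p t ∨_) (lookup-⋃⁺ ps t ps∋t)) (∨-true (lookup p t)))
  where
  ∨-true : ∀ b → b ∨ true ≡ true
  ∨-true true  = ≡.refl
  ∨-true false = ≡.refl

module _ {m n} (f : Fin m → Fin n) where

  private
    members : Subset m → List (Fin m)
    members S = filter (_∈? S) (allFin m)

    singleton-hit : ∀ {j t} → lookup ⁅ f j ⁆ t ≡ true → f j ≡ t
    singleton-hit {j} {t} hit with f j ≟ᶠ t | ≡.trans (≡.sym (lookup-⁅⁆ (f j) t)) hit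
    ... | yes fj≡t | _  = fj≡t
    ... | no _     | ()

  image⁻ : ∀ S t → lookup (image f S) t ≡ true → ∃ λ j → lookup S j ≡ true × f j ≡ t
  image⁻ S t hit =
    let j , j∈members , hitⱼ = find (AnyP.map⁻ (lookup-⋃⁻ _ t hit))
    in j , VecP.[]=⇒lookup (proj₂ (∈-filter⁻ (_∈? S) {xs = allFin m} j∈members)) , singleton-hit hitⱼ

  image⁺ : ∀ S j → lookup S j ≡ true → lookup (image f S) (f j) ≡ true
  image⁺ S j S∋j = lookup-⋃⁺ _ (f j) (AnyP.map⁺ (lose j∈members fj∈⁅fj⁆))
    where
    j∈members : j ∈ members S
    j∈members = ∈-filter⁺ (_∈? S) (∈-allFin j) (VecP.lookup⇒[]= j S S∋j)
    fj∈⁅fj⁆ : lookup ⁅ f j ⁆ (f j) ≡ true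
    fj∈⁅fj⁆ = ≡.trans (lookup-⁅⁆ (f j) (f j)) (dec-true (f j ≟ᶠ f j) ≡.refl)

  image-hit : Injective _≡_ _≡_ f → ∀ S j → lookup (image f S) (f j) ≡ lookup S j
  image-hit f-inj S j with lookup S j in S∋j
  ... | true  = image⁺ S j S∋j
  ... | false with lookup (image f S) (f j) in hit
  ...   | false = ≡.refl
  ...   | true  with image⁻ S (f j) hit
  ...     | j′ , S∋j′ , fj′≡fj with f-inj fj′≡fj
  ...       | ≡.refl = contradiction (≡.trans (≡.sym S∋j′) S∋j) λ ()

  image-miss : ∀ S t → (∀ j → f j ≢ t) → lookup (image f S) t ≡ false
  image-miss S t miss with lookup (image f S) t in hit
  ... | false = ≡.refl
  ... | true  = contradiction (proj₂ (proj₂ (image⁻ S t hit))) (miss _)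

erase : ∀ {n} → Subset n → Fin n → Subset n
erase (b ∷ C) zero    = outside ∷ C
erase (b ∷ C) (suc t) = b ∷ erase C t

lookup-erase-self : ∀ {n} (C : Subset n) t → lookup (erase C t) t ≡ false
lookup-erase-self (b ∷ C) zero    = ≡.refl
lookup-erase-self (b ∷ C) (suc t) = lookup-erase-self C t

lookup-erase-other : ∀ {n} (C : Subset n) {t u} → t ≢ u → lookup (erase C t) u ≡ lookup C u
lookup-erase-other (b ∷ C) {zero}  {zero}  t≢u = contradiction ≡.refl t≢u
lookup-erase-other (b ∷ C) {zero}  {suc u} t≢u = ≡.refl
lookup-erase-other (b ∷ C) {suc t} {zero}  t≢u = ≡.refl
lookup-erase-other (b ∷ C) {suc t} {suc u} t≢u = lookup-erase-other C (t≢u ∘ ≡.cong suc)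

lookup-erase-false : ∀ {n} (C : Subset n) t {u} → lookup C u ≡ false → lookup (erase C t) u ≡ false
lookup-erase-false C t {u} C∌u with t ≟ᶠ u
... | yes ≡.refl = lookup-erase-self C t
... | no t≢u     = ≡.trans (lookup-erase-other C t≢u) C∌u

count-erase-miss : ∀ {m n} (g : Fin m → Fin n) (C : Subset n) {t} → (∀ j → g j ≢ t) →
                   count (lookup (erase C t) ∘ g) ≡ count (lookup C ∘ g)
count-erase-miss g C miss = count-cong λ j → lookup-erase-other C (miss j ∘ ≡.sym)

count-erase-hit : ∀ {m n} {g : Fin m → Fin n} → Injective _≡_ _≡_ g → ∀ (C : Subset n) j →
                  lookup C (g j) ≡ true → count (lookup C ∘ g) ≡ suc (count (lookup (erase C (g j)) ∘ g))
count-erase-hit {g = g} g-inj C j C∋gj = count-switch j C∋gj (lookup-erase-self C (g j))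
  λ j′ j′≢j → lookup-erase-other C (j′≢j ∘ g-inj ∘ ≡.sym)

allSubsets-complete : ∀ n (τ : Subset n) → τ ∈ allSubsets n
allSubsets-complete zero    []          = here ≡.refl
allSubsets-complete (suc n) (false ∷ τ) = ∈-++⁺ˡ (∈-map⁺ (outside ∷_) (allSubsets-complete n τ))
allSubsets-complete (suc n) (true ∷ τ)  = ∈-++⁺ʳ (map (outside ∷_) (allSubsets n))
                                                 (∈-map⁺ (inside ∷_) (allSubsets-complete n τ))

module InclusionRows {c ℓ} (F : CommutativeRing c ℓ) where

  open CommutativeRing F
  open MonoidSums +-commutativeMonoid using (sum; sum-zero)
  open import Relation.Binary.Reasoning.Setoid setoid

  ∑ₛ : ∀ {n} → (Subset n → Carrier) → Carrier
  ∑ₛ {n} g = sumF F (map g (allSubsets n))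

  private
    sumF-++ : ∀ {A : Set} (g : A → Carrier) xs ys →
              sumF F (map g (xs ++ ys)) ≈ sumF F (map g xs) + sumF F (map g ys)
    sumF-++ g []       ys = sym (+-identityˡ _)
    sumF-++ g (x ∷ xs) ys = trans (+-congˡ (sumF-++ g xs ys)) (sym (+-assoc _ _ _))

    sumF-map : ∀ {A B : Set} (g : B → Carrier) (h : A → B) xs →
               sumF F (map g (map h xs)) ≡ sumF F (map (g ∘ h) xs)
    sumF-map g h []       = ≡.refl
    sumF-map g h (x ∷ xs) = ≡.cong (g (h x) +_) (sumF-map g h xs)

    sumF-zero : ∀ {A : Set} {g : A → Carrier} xs → (∀ a → g a ≈ 0#) → sumF F (map g xs) ≈ 0#
    sumF-zero []       g≈0 = refl
    sumF-zero (x ∷ xs) g≈0 = trans (+-cong (g≈0 x) (sumF-zero xs g≈0)) (+-identityˡ 0#)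

    sumF-filter : ∀ {A : Set} {p} {P : A → Set p} (P? : ∀ a → Dec (P a)) (g : A → Carrier) xs →
                  sumF F (map g (filter P? xs)) ≈ sumF F (map (λ a → if does (P? a) then g a else 0#) xs)
    sumF-filter P? g []       = refl
    sumF-filter P? g (x ∷ xs) with does (P? x)
    ... | true  = +-congˡ (sumF-filter P? g xs)
    ... | false = trans (sumF-filter P? g xs) (sym (+-identityˡ _))

  ∑ₛ-suc : ∀ {n} (g : Subset (suc n) → Carrier) →
           ∑ₛ g ≈ ∑ₛ (g ∘ (outside ∷_)) + ∑ₛ (g ∘ (inside ∷_))
  ∑ₛ-suc {n} g = trans (sumF-++ g (map (outside ∷_) (allSubsets n)) (map (inside ∷_) (allSubsets n)))
    (+-cong (reflexive (sumF-map g (outside ∷_) (allSubsets n))) (reflexive (sumF-map g (inside ∷_) (allSubsets n))))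

  ∑ₛ-zero : ∀ {n} {g : Subset n → Carrier} → (∀ B → g B ≈ 0#) → ∑ₛ g ≈ 0#
  ∑ₛ-zero {n} = sumF-zero (allSubsets n)

  restrict : ∀ {n} → Subset n → ℕ → (Subset n → Carrier) → Subset n → Carrier
  restrict C s f B = if does (B ⊆? C) ∧ does (∣ B ∣ ℕ.≟ s) then f B else 0#

  private
    no-larger : ∀ {n} (B C : Subset n) s → ∣ C ∣ ≡ s → does (B ⊆? C) ∧ does (∣ B ∣ ℕ.≟ suc s) ≡ false
    no-larger B C s ∣C∣≡s with B ⊆? C
    ... | no _    = ≡.refl
    ... | yes B⊆C = dec-false (∣ B ∣ ℕ.≟ suc s) λ ∣B∣≡1+s →
          ℕP.<-irrefl ≡.refl (ℕP.≤-trans (ℕP.≤-reflexive (≡.sym ∣B∣≡1+s))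
                                          (ℕP.≤-trans (p⊆q⇒∣p∣≤∣q∣ B⊆C) (ℕP.≤-reflexive ∣C∣≡s)))

    outside-excludes : ∀ {n} (C : Subset n) s f B → restrict (outside ∷ C) s f (inside ∷ B) ≈ 0#
    outside-excludes C s f B = refl

  ∑-restrict-top : ∀ {n} (C : Subset n) s (f : Subset n → Carrier) → ∣ C ∣ ≡ s →
                   ∑ₛ (restrict C s f) ≈ f C
  ∑-restrict-top [] s f ≡.refl = +-identityʳ _
  ∑-restrict-top (outside ∷ C) s f ∣C∣≡s = begin
    ∑ₛ (restrict (outside ∷ C) s f)
      ≈⟨ ∑ₛ-suc (restrict (outside ∷ C) s f) ⟩
    ∑ₛ (restrict C s (f ∘ (outside ∷_))) + ∑ₛ (λ B → restrict (outside ∷ C) s f (inside ∷ B))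
      ≈⟨ +-cong (∑-restrict-top C s (f ∘ (outside ∷_)) ∣C∣≡s) (∑ₛ-zero (outside-excludes C s f)) ⟩
    f (outside ∷ C) + 0#
      ≈⟨ +-identityʳ _ ⟩
    f (outside ∷ C) ∎
  ∑-restrict-top (inside ∷ C) (suc s) f ∣C∣≡1+s = begin
    ∑ₛ (restrict (inside ∷ C) (suc s) f)
      ≈⟨ ∑ₛ-suc (restrict (inside ∷ C) (suc s) f) ⟩
    ∑ₛ (λ B → restrict (inside ∷ C) (suc s) f (outside ∷ B)) + ∑ₛ (restrict C s (f ∘ (inside ∷_)))
      ≈⟨ +-cong (∑ₛ-zero too-large) (∑-restrict-top C s (f ∘ (inside ∷_)) ∣C∣≡s) ⟩
    0# + f (inside ∷ C)
      ≈⟨ +-identityˡ _ ⟩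
    f (inside ∷ C) ∎
    where
    ∣C∣≡s : ∣ C ∣ ≡ s
    ∣C∣≡s = ℕP.suc-injective ∣C∣≡1+s
    too-large : ∀ B → restrict (inside ∷ C) (suc s) f (outside ∷ B) ≈ 0#
    too-large B = reflexive (≡.cong (λ b → if b then f (outside ∷ B) else 0#) (no-larger B C s ∣C∣≡s))

  facetSum : ∀ {n} → Subset n → (Subset n → Carrier) → Carrier
  facetSum C f = sum (λ t → if lookup C t then f (erase C t) else 0#)

  ∑-restrict-facets : ∀ {n} (C : Subset n) s (f : Subset n → Carrier) → ∣ C ∣ ≡ suc s →
                      ∑ₛ (restrict C s f) ≈ facetSum C f
  ∑-restrict-facets (outside ∷ C) s f ∣C∣≡1+s = begin
    ∑ₛ (restrict (outside ∷ C) s f)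
      ≈⟨ ∑ₛ-suc (restrict (outside ∷ C) s f) ⟩
    ∑ₛ (restrict C s (f ∘ (outside ∷_))) + ∑ₛ (λ B → restrict (outside ∷ C) s f (inside ∷ B))
      ≈⟨ +-cong (∑-restrict-facets C s (f ∘ (outside ∷_)) ∣C∣≡1+s) (∑ₛ-zero (outside-excludes C s f)) ⟩
    facetSum C (f ∘ (outside ∷_)) + 0#
      ≈⟨ trans (+-identityʳ _) (sym (+-identityˡ _)) ⟩
    facetSum (outside ∷ C) f ∎
  ∑-restrict-facets (inside ∷ C) zero f ∣C∣≡1 = begin
    ∑ₛ (restrict (inside ∷ C) 0 f)
      ≈⟨ ∑ₛ-suc (restrict (inside ∷ C) 0 f) ⟩
    ∑ₛ (restrict C 0 (f ∘ (outside ∷_))) + ∑ₛ (λ B → restrict (inside ∷ C) 0 f (inside ∷ B))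
      ≈⟨ +-cong (∑-restrict-top C 0 (f ∘ (outside ∷_)) ∣C∣≡0) (∑ₛ-zero nonempty) ⟩
    f (outside ∷ C) + 0#
      ≈⟨ +-congˡ (sum-zero no-facet) ⟨
    facetSum (inside ∷ C) f ∎
    where
    ∣C∣≡0 : ∣ C ∣ ≡ 0
    ∣C∣≡0 = ℕP.suc-injective ∣C∣≡1
    nonempty : ∀ B → restrict (inside ∷ C) 0 f (inside ∷ B) ≈ 0#
    nonempty B with does (B ⊆? C)
    ... | true  = refl
    ... | false = refl
    no-facet : ∀ t → (if lookup C t then f (inside ∷ erase C t) else 0#) ≈ 0#
    no-facet t = reflexive (≡.cong (λ b → if b then f (inside ∷ erase C t) else 0#)
                                   (count≡0 (lookup C) (≡.trans (≡.sym (∣∣-count C)) ∣C∣≡0) t))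
  ∑-restrict-facets (inside ∷ C) (suc s) f ∣C∣≡2+s = begin
    ∑ₛ (restrict (inside ∷ C) (suc s) f)
      ≈⟨ ∑ₛ-suc (restrict (inside ∷ C) (suc s) f) ⟩
    ∑ₛ (restrict C (suc s) (f ∘ (outside ∷_))) + ∑ₛ (restrict C s (f ∘ (inside ∷_)))
      ≈⟨ +-cong (∑-restrict-top C (suc s) (f ∘ (outside ∷_)) ∣C∣≡1+s)
                (∑-restrict-facets C s (f ∘ (inside ∷_)) ∣C∣≡1+s) ⟩
    facetSum (inside ∷ C) f ∎
    where
    ∣C∣≡1+s : ∣ C ∣ ≡ suc s
    ∣C∣≡1+s = ℕP.suc-injective ∣C∣≡2+s

  inclusion-row : ∀ {n} (C : Subset n) s (w : Subset n → Carrier) → ∣ C ∣ ≡ suc s →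
                  sumF F (map (λ B → inclEntry F C B * w B) (subsetsOfSize F n s)) ≈ facetSum C w
  inclusion-row {n} C s w ∣C∣≡1+s = begin
    sumF F (map (λ B → inclEntry F C B * w B) (subsetsOfSize F n s))
      ≈⟨ sumF-filter (λ B → ∣ B ∣ ℕ.≟ s) _ (allSubsets n) ⟩
    ∑ₛ (λ B → if does (∣ B ∣ ℕ.≟ s) then inclEntry F C B * w B else 0#)
      ≈⟨ sumF-cong (allSubsets n) entry ⟩
    ∑ₛ (restrict C s w)
      ≈⟨ ∑-restrict-facets C s w ∣C∣≡1+s ⟩
    facetSum C w ∎
    where
    sumF-cong : ∀ {g h : Subset n → Carrier} xs → (∀ B → g B ≈ h B) → sumF F (map g xs) ≈ sumF F (map h xs)
    sumF-cong []       g≈h = refl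
    sumF-cong (B ∷ xs) g≈h = +-cong (g≈h B) (sumF-cong xs g≈h)
    entry : ∀ B → (if does (∣ B ∣ ℕ.≟ s) then inclEntry F C B * w B else 0#) ≈ restrict C s w B
    entry B with B ⊆? C | does (∣ B ∣ ℕ.≟ s)
    ... | yes _ | true  = *-identityˡ _
    ... | no _  | true  = zeroˡ _
    ... | yes _ | false = refl
    ... | no _  | false = refl

module Multiples {c ℓ} (F : CommutativeRing c ℓ) where

  open CommutativeRing F hiding (zero)
  open import Algebra.Properties.Semiring.Mult semiring public
    using (×-homo-+; ×-assoc-*; ×-comm-*; ×-congʳ) renaming (_×_ to _×ᵣ_)
  open MonoidSums +-commutativeMonoid using (sum)

  ·1≡×1 : ∀ m → _·1 F m ≡ m ×ᵣ 1#
  ·1≡×1 zero    = ≡.refl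
  ·1≡×1 (suc m) = ≡.cong (1# +_) (·1≡×1 m)

  ×1-* : ∀ m u → (m ×ᵣ 1#) * u ≈ m ×ᵣ u
  ×1-* m u = trans (×-assoc-* m 1# u) (×-congʳ m (*-identityˡ u))

  sum-select : ∀ {m} (b : Fin m → Bool) u → sum (λ j → if b j then u else 0#) ≈ count b ×ᵣ u
  sum-select {zero}  b u = refl
  sum-select {suc m} b u with b zero
  ... | true  = +-congˡ (sum-select (b ∘ suc) u)
  ... | false = trans (+-identityˡ _) (sum-select (b ∘ suc) u)

  ×-factor : ∀ J r s u v → J ×ᵣ (s * u) + r ×ᵣ (s * v) ≈ s * (J ×ᵣ u + r ×ᵣ v)
  ×-factor J r s u v = trans (+-cong (sym (×-comm-* J s u)) (sym (×-comm-* r s v))) (sym (distribˡ s _ _))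

  sign-cancel : ∀ s u → s * u + ((- 1#) * s) * u ≈ 0#
  sign-cancel s u = trans (sym (distribʳ u s ((- 1#) * s)))
    (trans (*-congʳ (trans (+-congˡ (-1*x≈-x s)) (-‿inverseʳ s))) (zeroˡ u))
    where open import Algebra.Properties.Ring ring using (-1*x≈-x)

  module Reciprocals (d : ℕ) (a : ℕ → Carrier) (a-inv : ∀ j → j < d → suc j ×ᵣ a j ≈ 1#)
                     (char : suc d ×ᵣ 1# ≈ 0#) where

    full-row : ∀ {e} → d ≡ suc e → d ×ᵣ a (d ∸ 1) ≈ 1#
    full-row {e} ≡.refl = a-inv e ℕP.≤-refl

    vanishing-row : ∀ J r → J ℕ.+ suc r ≡ d → 1 ≤ J → J ×ᵣ a (J ∸ 1) + suc r ×ᵣ a J ≈ 0#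
    vanishing-row (suc J) r J+r≡d _ = begin
      suc J ×ᵣ a J + suc r ×ᵣ a (suc J)              ≈⟨ +-congʳ (a-inv J J<d) ⟩
      1# + suc r ×ᵣ a (suc J)                        ≈⟨ +-congʳ (a-inv (suc J) 1+J<d) ⟨
      suc (suc J) ×ᵣ a (suc J) + suc r ×ᵣ a (suc J)  ≈⟨ ×-homo-+ (a (suc J)) (suc (suc J)) (suc r) ⟨
      (suc (suc J) ℕ.+ suc r) ×ᵣ a (suc J)           ≡⟨ ≡.cong (λ m → m ×ᵣ a (suc J)) (≡.cong suc J+r≡d) ⟩
      suc d ×ᵣ a (suc J)                             ≈⟨ ×1-* (suc d) (a (suc J)) ⟨
      (suc d ×ᵣ 1#) * a (suc J)                      ≈⟨ *-congʳ char ⟩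
      0# * a (suc J)                                 ≈⟨ zeroˡ _ ⟩
      0#                                             ∎
      where
      open import Relation.Binary.Reasoning.Setoid setoid
      1+J<d : suc J < d
      1+J<d = ℕP.≤-trans (s≤s (ℕP.m≤m+n (suc J) r)) (ℕP.≤-reflexive (≡.trans (≡.sym (ℕP.+-suc (suc J) r)) J+r≡d))
      J<d : J < d
      J<d = ℕP.<-trans (ℕP.n<1+n J) 1+J<d

module Configuration {n i d : ℕ} (x y : Fin i → Fin n) (δ : Fin d → Fin n)
  (x-inj : Injective _≡_ _≡_ x) (y-inj : Injective _≡_ _≡_ y) (δ-inj : Injective _≡_ _≡_ δ)
  (x≢y : ∀ a b → x a ≢ y b) (x≢δ : ∀ a b → x a ≢ δ b) (y≢δ : ∀ a b → y a ≢ δ b) where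

  data Kind (t : Fin n) : Set where
    in-X : ∀ j → x j ≡ t → Kind t
    in-Y : ∀ j → y j ≡ t → Kind t
    in-Δ : ∀ j → δ j ≡ t → Kind t
    in-R : (∀ j → x j ≢ t) → (∀ j → y j ≢ t) → (∀ j → δ j ≢ t) → Kind t

  kind : ∀ t → Kind t
  kind t with any? (λ j → x j ≟ᶠ t) | any? (λ j → y j ≟ᶠ t) | any? (λ j → δ j ≟ᶠ t)
  ... | yes (j , e) | _           | _           = in-X j e
  ... | no _        | yes (j , e) | _           = in-Y j e
  ... | no _        | no _        | yes (j , e) = in-Δ j e
  ... | no ∉X       | no ∉Y       | no ∉Δ       = in-R (λ j e → ∉X (j , e)) (λ j e → ∉Y (j , e)) (λ j e → ∉Δ (j , e))

  isRest : ∀ {t} → Kind t → Bool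
  isRest (in-R _ _ _) = true
  isRest (in-X _ _)   = false
  isRest (in-Y _ _)   = false
  isRest (in-Δ _ _)   = false

  rest : Fin n → Bool
  rest t = isRest (kind t)

  rest⁻ : ∀ {t} → rest t ≡ true → (∀ j → x j ≢ t) × (∀ j → y j ≢ t) × (∀ j → δ j ≢ t)
  rest⁻ {t} = go (kind t)
    where
    go : (k : Kind t) → isRest k ≡ true → (∀ j → x j ≢ t) × (∀ j → y j ≢ t) × (∀ j → δ j ≢ t)
    go (in-R ∉X ∉Y ∉Δ) _ = ∉X , ∉Y , ∉Δ

  module Partition {a ℓ} (M : CommutativeMonoid a ℓ) where

    open CommutativeMonoid M renaming (_∙_ to _+_; ε to 0#; ∙-cong to +-cong; ∙-congˡ to +-congˡ; ∙-congʳ to +-congʳ;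
      identityʳ to +-identityʳ; identityˡ to +-identityˡ)
    open MonoidSums M
    open import Relation.Binary.Reasoning.Setoid setoid

    private
      onR : (Fin n → Carrier) → Fin n → Carrier
      onR f t = if rest t then f t else 0#

      pieces : (Fin n → Carrier) → Fin n → Carrier
      pieces f t = ((fibre x t (f t) + fibre y t (f t)) + fibre δ t (f t)) + onR f t

      one-piece : ∀ (f : Fin n → Carrier) t (k : Kind t) →
        f t ≈ ((fibre x t (f t) + fibre y t (f t)) + fibre δ t (f t)) + (if isRest k then f t else 0#)
      one-piece f t (in-X j e) = sym (trans
        (+-congʳ (+-cong (+-cong (fibre-hit x x-inj (f t) e)
                                 (fibre-miss y (f t) λ j′ e′ → x≢y j j′ (≡.trans e (≡.sym e′))))
                         (fibre-miss δ (f t) λ j′ e′ → x≢δ j j′ (≡.trans e (≡.sym e′)))))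
        (trans (+-identityʳ _) (trans (+-identityʳ _) (+-identityʳ _))))
      one-piece f t (in-Y j e) = sym (trans
        (+-congʳ (+-cong (+-cong (fibre-miss x (f t) λ j′ e′ → x≢y j′ j (≡.trans e′ (≡.sym e)))
                                 (fibre-hit y y-inj (f t) e))
                         (fibre-miss δ (f t) λ j′ e′ → y≢δ j j′ (≡.trans e (≡.sym e′)))))
        (trans (+-identityʳ _) (trans (+-identityʳ _) (+-identityˡ _))))
      one-piece f t (in-Δ j e) = sym (trans
        (+-congʳ (+-cong (+-cong (fibre-miss x (f t) λ j′ e′ → x≢δ j′ j (≡.trans e′ (≡.sym e)))
                                 (fibre-miss y (f t) λ j′ e′ → y≢δ j′ j (≡.trans e′ (≡.sym e))))
                         (fibre-hit δ δ-inj (f t) e)))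
        (trans (+-identityʳ _) (trans (+-congʳ (+-identityˡ 0#)) (+-identityˡ _))))
      one-piece f t (in-R ∉X ∉Y ∉Δ) = sym (trans
        (+-congʳ (+-cong (+-cong (fibre-miss x (f t) ∉X) (fibre-miss y (f t) ∉Y)) (fibre-miss δ (f t) ∉Δ)))
        (trans (+-congʳ (trans (+-identityʳ _) (+-identityʳ _))) (+-identityˡ _)))

    partition : ∀ (f : Fin n → Carrier) →
      sum f ≈ ((∑[ j < i ] f (x j) + ∑[ j < i ] f (y j)) + ∑[ j < d ] f (δ j)) + ∑[ t < n ] (if rest t then f t else 0#)
    partition f = begin
      sum f
        ≈⟨ sum-cong-≋ (λ t → one-piece f t (kind t)) ⟩
      sum (pieces f)
        ≈⟨ ∑-distrib-+ _ (onR f) ⟩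
      sum (λ t → (fibre x t (f t) + fibre y t (f t)) + fibre δ t (f t)) + sum (onR f)
        ≈⟨ +-congʳ (∑-distrib-+ _ (λ t → fibre δ t (f t))) ⟩
      (sum (λ t → fibre x t (f t) + fibre y t (f t)) + sum (λ t → fibre δ t (f t))) + sum (onR f)
        ≈⟨ +-congʳ (+-congʳ (∑-distrib-+ (λ t → fibre x t (f t)) (λ t → fibre y t (f t)))) ⟩
      ((sum (λ t → fibre x t (f t)) + sum (λ t → fibre y t (f t))) + sum (λ t → fibre δ t (f t))) + sum (onR f)
        ≈⟨ +-congʳ (+-cong (+-cong (sum-fibres x f) (sum-fibres y f)) (sum-fibres δ f)) ⟩
      ((∑[ j < i ] f (x j) + ∑[ j < i ] f (y j)) + ∑[ j < d ] f (δ j)) + sum (onR f) ∎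

  #X #Y #Δ #R : Subset n → ℕ
  #X C = count (lookup C ∘ x)
  #Y C = count (lookup C ∘ y)
  #Δ C = count (lookup C ∘ δ)
  #R C = count (λ t → rest t ∧ lookup C t)

  open Partition ℕP.+-0-commutativeMonoid renaming (partition to partitionℕ)

  private
    ind-∧ : ∀ r b → (if r then ind b else 0) ≡ ind (r ∧ b)
    ind-∧ true  b = ≡.refl
    ind-∧ false b = ≡.refl

  card-split : ∀ C → ∣ C ∣ ≡ #X C ℕ.+ #Y C ℕ.+ #Δ C ℕ.+ #R C
  card-split C = ≡.trans (∣∣-count C) (≡.trans (partitionℕ (ind ∘ lookup C))
    (≡.cong (#X C ℕ.+ #Y C ℕ.+ #Δ C ℕ.+_) (ℕ-Sums.sum-cong-≋ λ t → ind-∧ (rest t) (lookup C t))))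

  size-split : n ≡ i ℕ.+ i ℕ.+ d ℕ.+ count rest
  size-split = begin
    n                                       ≡⟨ sum-ones n ⟨
    ℕ-Sums.∑[ t < n ] 1                     ≡⟨ partitionℕ (λ _ → 1) ⟩
    ℕ-Sums.∑[ j < i ] 1 ℕ.+ ℕ-Sums.∑[ j < i ] 1 ℕ.+ ℕ-Sums.∑[ j < d ] 1
      ℕ.+ ℕ-Sums.∑[ t < n ] (if rest t then 1 else 0)
      ≡⟨ ≡.cong₂ ℕ._+_ (≡.cong₂ ℕ._+_ (≡.cong₂ ℕ._+_ (sum-ones i) (sum-ones i)) (sum-ones d))
                       (ℕ-Sums.sum-cong-≋ λ t → ind-∧ (rest t) true) ⟩
    i ℕ.+ i ℕ.+ d ℕ.+ count (λ t → rest t ∧ true)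
      ≡⟨ ≡.cong (i ℕ.+ i ℕ.+ d ℕ.+_) (count-cong λ t → ∧-true (rest t)) ⟩
    i ℕ.+ i ℕ.+ d ℕ.+ count rest ∎
    where
    open ≡.≡-Reasoning
    ∧-true : ∀ b → b ∧ true ≡ b
    ∧-true true  = ≡.refl
    ∧-true false = ≡.refl

  Balanced : Subset n → Set
  Balanced C = ∀ j → lookup C (y j) ≡ not (lookup C (x j))

  balanced? : ∀ C → Dec (Balanced C)
  balanced? C = all? λ j → lookup C (y j) ≟ᵇ not (lookup C (x j))

  balanced-#X+#Y : ∀ {C} → Balanced C → #X C ℕ.+ #Y C ≡ i
  balanced-#X+#Y {C} bal = begin
    #X C ℕ.+ #Y C
      ≡⟨ ℕ-Sums.∑-distrib-+ (ind ∘ lookup C ∘ x) (ind ∘ lookup C ∘ y) ⟨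
    ℕ-Sums.∑[ j < i ] (ind (lookup C (x j)) ℕ.+ ind (lookup C (y j)))
      ≡⟨ ℕ-Sums.sum-cong-≋ one-of ⟩
    ℕ-Sums.∑[ j < i ] 1
      ≡⟨ sum-ones i ⟩
    i ∎
    where
    open ≡.≡-Reasoning
    ind-not : ∀ b → ind b ℕ.+ ind (not b) ≡ 1
    ind-not true  = ≡.refl
    ind-not false = ≡.refl
    one-of : ∀ j → ind (lookup C (x j)) ℕ.+ ind (lookup C (y j)) ≡ 1
    one-of j = ≡.trans (≡.cong (λ b → ind (lookup C (x j)) ℕ.+ ind b) (bal j)) (ind-not (lookup C (x j)))

  unbalanced-at : ∀ {C} j → lookup C (y j) ≡ lookup C (x j) → ¬ Balanced C
  unbalanced-at j same bal = not-¬ same (bal j)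

  unbalanced-pair : ∀ {C} → ¬ Balanced C → ∃ λ j → lookup C (y j) ≡ lookup C (x j)
  unbalanced-pair {C} ¬bal with ¬∀⟶∃¬ i _ (λ j → lookup C (y j) ≟ᵇ not (lookup C (x j))) ¬bal
  ... | j , ¬bal-j = j , ≡.trans (¬-not ¬bal-j) (not-involutive _)

  agree-x⇒y : ∀ {C D} → Balanced C → Balanced D → ∀ j →
              lookup D (x j) ≡ lookup C (x j) → lookup D (y j) ≡ lookup C (y j)
  agree-x⇒y balC balD j same = ≡.trans (balD j) (≡.trans (≡.cong not same) (≡.sym (balC j)))

  agree-y⇒x : ∀ {C D} → Balanced C → Balanced D → ∀ j →
              lookup D (y j) ≡ lookup C (y j) → lookup D (x j) ≡ lookup C (x j)
  agree-y⇒x balC balD j same = not-injective (≡.trans (≡.sym (balD j)) (≡.trans same (balC j)))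

  erase-x-unbalances : ∀ {C} → Balanced C → ∀ j → lookup C (x j) ≡ true → ¬ Balanced (erase C (x j))
  erase-x-unbalances {C} bal j C∋xj bal′ = contradiction
    (≡.trans (≡.sym (lookup-erase-self C (x j)))
      (≡.trans (agree-y⇒x {C} {erase C (x j)} bal bal′ j (lookup-erase-other C (x≢y j j))) C∋xj)) λ ()

  erase-y-unbalances : ∀ {C} → Balanced C → ∀ j → lookup C (y j) ≡ true → ¬ Balanced (erase C (y j))
  erase-y-unbalances {C} bal j C∋yj bal′ = contradiction
    (≡.trans (≡.sym (lookup-erase-self C (y j)))
      (≡.trans (agree-x⇒y {C} {erase C (y j)} bal bal′ j (lookup-erase-other C (x≢y j j ∘ ≡.sym))) C∋yj)) λ ()

  erase-keeps-balance : ∀ {C t} → Balanced C → (∀ j → x j ≢ t) → (∀ j → y j ≢ t) → Balanced (erase C t)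
  erase-keeps-balance {C} bal ∉X ∉Y j = ≡.trans (lookup-erase-other C (∉Y j ∘ ≡.sym))
    (≡.trans (bal j) (≡.cong not (≡.sym (lookup-erase-other C (∉X j ∘ ≡.sym)))))

  balance-transfer : ∀ {D D′} j₀ →
    (∀ j → j ≢ j₀ → lookup D′ (x j) ≡ lookup D (x j) × lookup D′ (y j) ≡ lookup D (y j)) →
    lookup D′ (y j₀) ≡ not (lookup D′ (x j₀)) → Balanced D → Balanced D′
  balance-transfer j₀ agree bal-j₀ bal j with j ≟ᶠ j₀
  ... | yes ≡.refl = bal-j₀
  ... | no j≢j₀    = let same-x , same-y = agree j j≢j₀
                     in ≡.trans same-y (≡.trans (bal j) (≡.cong not (≡.sym same-x)))

  -- The sets X_τ ∪ (Y ∖ Y_τ) ∪ Δ.  (This is Cset of the definitions, which does not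
  -- involve the field.)
  config : Subset i → Subset n
  config τ = (image x τ ∪ (image y ⊤ ─ image y τ)) ∪ image δ ⊤

  lookup-config : ∀ τ t → lookup (config τ) t ≡
    (lookup (image x τ) t ∨ (not (lookup (image y τ) t) ∧ lookup (image y ⊤) t)) ∨ lookup (image δ ⊤) t
  lookup-config τ t = ≡.trans (lookup-∪ (image x τ ∪ (image y ⊤ ─ image y τ)) (image δ ⊤) t)
    (≡.cong (_∨ lookup (image δ ⊤) t) (≡.trans (lookup-∪ (image x τ) (image y ⊤ ─ image y τ) t)
      (≡.cong (lookup (image x τ) t ∨_) (lookup-─ (image y ⊤) (image y τ) t))))

  config-x : ∀ τ j → lookup (config τ) (x j) ≡ lookup τ j
  config-x τ j rewrite lookup-config τ (x j) | image-hit x x-inj τ j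
    | image-miss y τ (x j) (λ j′ → x≢y j j′ ∘ ≡.sym) | image-miss y ⊤ (x j) (λ j′ → x≢y j j′ ∘ ≡.sym)
    | image-miss δ ⊤ (x j) (λ j′ → x≢δ j j′ ∘ ≡.sym) = ≡.trans (∨-identityʳ _) (∨-identityʳ _)

  config-y : ∀ τ j → lookup (config τ) (y j) ≡ not (lookup τ j)
  config-y τ j rewrite lookup-config τ (y j) | image-miss x τ (y j) (λ j′ → x≢y j′ j)
    | image-hit y y-inj τ j | image-hit y y-inj ⊤ j | lookup-⊤ j
    | image-miss δ ⊤ (y j) (λ j′ → y≢δ j j′ ∘ ≡.sym) = ≡.trans (∨-identityʳ _) (∧-identityʳ _)

  config-δ : ∀ τ j → lookup (config τ) (δ j) ≡ true
  config-δ τ j rewrite lookup-config τ (δ j) | image-hit δ δ-inj ⊤ j | lookup-⊤ j = ∨-zeroʳ _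

  config-R : ∀ τ {t} → (∀ j → x j ≢ t) → (∀ j → y j ≢ t) → (∀ j → δ j ≢ t) → lookup (config τ) t ≡ false
  config-R τ {t} ∉X ∉Y ∉Δ rewrite lookup-config τ t | image-miss x τ t ∉X | image-miss y τ t ∉Y
    | image-miss y ⊤ t ∉Y | image-miss δ ⊤ t ∉Δ = ≡.refl

  config-balanced : ∀ τ → Balanced (config τ)
  config-balanced τ j = ≡.trans (config-y τ j) (≡.cong not (≡.sym (config-x τ j)))

  #X-config : ∀ τ → #X (config τ) ≡ ∣ τ ∣
  #X-config τ = ≡.trans (count-cong (config-x τ)) (≡.sym (∣∣-count τ))

  #R-config : ∀ τ → #R (config τ) ≡ 0
  #R-config τ = ≡.trans (count-cong λ t → outside-R t (kind t)) (ℕ-Sums.sum-replicate-zero n)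
    where
    outside-R : ∀ t (k : Kind t) → isRest k ∧ lookup (config τ) t ≡ false
    outside-R t (in-X _ _)        = ≡.refl
    outside-R t (in-Y _ _)        = ≡.refl
    outside-R t (in-Δ _ _)        = ≡.refl
    outside-R t (in-R ∉X ∉Y ∉Δ) = config-R τ ∉X ∉Y ∉Δ

  config-complete : ∀ C → Balanced C → #R C ≡ 0 → #Δ C ≡ d → C ≡ config (tabulate (lookup C ∘ x))
  config-complete C bal #R≡0 #Δ≡d = begin
    C                            ≡⟨ VecP.tabulate∘lookup C ⟨
    tabulate (lookup C)          ≡⟨ VecP.tabulate-cong (λ t → pointwise t (kind t) (count≡0 _ #R≡0 t)) ⟩
    tabulate (lookup (config τ)) ≡⟨ VecP.tabulate∘lookup (config τ) ⟩
    config τ                     ∎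
    where
    open ≡.≡-Reasoning
    τ : Subset i
    τ = tabulate (lookup C ∘ x)
    pointwise : ∀ t (k : Kind t) → isRest k ∧ lookup C t ≡ false → lookup C t ≡ lookup (config τ) t
    pointwise t (in-X j ≡.refl) _ = ≡.sym (≡.trans (config-x τ j) (VecP.lookup∘tabulate _ j))
    pointwise t (in-Y j ≡.refl) _ = ≡.trans (bal j)
      (≡.sym (≡.trans (config-y τ j) (≡.cong not (VecP.lookup∘tabulate _ j))))
    pointwise t (in-Δ j ≡.refl) _ = ≡.trans (count≡m _ #Δ≡d j) (≡.sym (config-δ τ j))
    pointwise t (in-R ∉X ∉Y ∉Δ) C∌t = ≡.trans C∌t (≡.sym (config-R τ ∉X ∉Y ∉Δ))

  balanced-#Δ+#R : ∀ {C} → Balanced C → ∣ C ∣ ≡ i ℕ.+ d → #Δ C ℕ.+ #R C ≡ d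
  balanced-#Δ+#R {C} bal ∣C∣≡i+d = ℕP.+-cancelˡ-≡ i (#Δ C ℕ.+ #R C) d (begin
    i ℕ.+ (#Δ C ℕ.+ #R C)                   ≡⟨ ≡.cong (ℕ._+ (#Δ C ℕ.+ #R C)) (balanced-#X+#Y {C} bal) ⟨
    (#X C ℕ.+ #Y C) ℕ.+ (#Δ C ℕ.+ #R C)     ≡⟨ ℕP.+-assoc (#X C ℕ.+ #Y C) (#Δ C) (#R C) ⟨
    #X C ℕ.+ #Y C ℕ.+ #Δ C ℕ.+ #R C         ≡⟨ card-split C ⟨
    ∣ C ∣                                   ≡⟨ ∣C∣≡i+d ⟩
    i ℕ.+ d                                 ∎)
    where open ≡.≡-Reasoning

  -- If the (i + d)-sets are the (k - 1)-subsets of a (2k - 3)-set, i.e. n + 1 = 2(i + d),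
  -- then |R| = d - 1.
  rest-size : n ℕ.+ 1 ≡ (i ℕ.+ d) ℕ.+ (i ℕ.+ d) → suc (count rest) ≡ d
  rest-size n+1≡ = ℕP.+-cancelˡ-≡ (i ℕ.+ i ℕ.+ d) (suc (count rest)) d (begin
    i ℕ.+ i ℕ.+ d ℕ.+ suc (count rest)  ≡⟨ shift-one (i ℕ.+ i ℕ.+ d) (count rest) ⟩
    i ℕ.+ i ℕ.+ d ℕ.+ count rest ℕ.+ 1  ≡⟨ ≡.cong (ℕ._+ 1) size-split ⟨
    n ℕ.+ 1                             ≡⟨ n+1≡ ⟩
    (i ℕ.+ d) ℕ.+ (i ℕ.+ d)             ≡⟨ regroup i d ⟩
    i ℕ.+ i ℕ.+ d ℕ.+ d                 ∎)
    where
    open ≡.≡-Reasoning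
    shift-one : ∀ m r → m ℕ.+ suc r ≡ m ℕ.+ r ℕ.+ 1
    shift-one = solve-∀
    regroup : ∀ i d → (i ℕ.+ d) ℕ.+ (i ℕ.+ d) ≡ i ℕ.+ i ℕ.+ d ℕ.+ d
    regroup = solve-∀

  meets-Δ : ∀ C → #Δ C ℕ.+ #R C ≡ d → suc (count rest) ≡ d → 1 ≤ #Δ C
  meets-Δ C J+r≡d 1+|R|≡d with #Δ C
  ... | suc _ = s≤s z≤n
  ... | zero  = contradiction (count-∧ rest (lookup C))
                  (ℕP.<⇒≱ (ℕP.≤-reflexive (≡.trans 1+|R|≡d (≡.sym J+r≡d))))

  module Values {c ℓ} (F : CommutativeRing c ℓ) where

    open CommutativeRing F

    findτ-sound : ∀ C L τ → findτ F x y δ C L ≡ just τ → C ≡ config τ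
    findτ-sound C (τ′ ∷ L) τ found with VecP.≡-dec _≟ᵇ_ C (Cset F x y δ τ′)
    ... | yes C≡τ′ = ≡.trans C≡τ′ (≡.cong config (just-injective found))
    ... | no _     = findτ-sound C L τ found

    findτ-complete : ∀ C L τ → τ ∈ L → C ≡ config τ → findτ F x y δ C L ≢ nothing
    findτ-complete C (τ′ ∷ L) τ τ∈ C≡τ with VecP.≡-dec _≟ᵇ_ C (Cset F x y δ τ′)
    ... | yes _ = λ ()
    ... | no C≢τ′ with τ∈
    ...   | here ≡.refl = contradiction C≡τ C≢τ′
    ...   | there τ∈L   = findτ-complete C L τ τ∈L C≡τ

    vVec-config : ∀ C τ → C ≡ config τ → vVec F x y δ C ≈ signPow F (#X C)
    vVec-config C τ C≡τ with findτ F x y δ C (allSubsets i) in found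
    ... | just τ′ = reflexive (≡.cong (signPow F)
                      (≡.sym (≡.trans (≡.cong #X (findτ-sound C (allSubsets i) τ′ found)) (#X-config τ′))))
    ... | nothing = contradiction found (findτ-complete C (allSubsets i) τ (allSubsets-complete i τ) C≡τ)

    vVec-other : ∀ C → (∀ τ → C ≢ config τ) → vVec F x y δ C ≈ 0#
    vVec-other C C≢τ with findτ F x y δ C (allSubsets i) in found
    ... | just τ′ = contradiction (findτ-sound C (allSubsets i) τ′ found) (C≢τ τ′)
    ... | nothing = refl

  module ColumnSpace {c ℓ} (F : CommutativeRing c ℓ) (a : ℕ → CommutativeRing.Carrier F) where

    open CommutativeRing F hiding (zero)
    open Multiples F
    open MonoidSums +-commutativeMonoid using (sum; sum-zero; sum-pair; sum-cong-≋)
    open InclusionRows F using (facetSum; inclusion-row)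
    open Partition +-commutativeMonoid renaming (partition to partitionF)
    open Values F
    open import Relation.Binary.Reasoning.Setoid setoid

    sign : Subset n → Carrier
    sign C = signPow F (#X C)

    weight : Subset n → Carrier
    weight B = if does (balanced? B) then sign B * a (#Δ B) else 0#

    weight-balanced : ∀ {B} → Balanced B → weight B ≡ sign B * a (#Δ B)
    weight-balanced {B} bal = ≡.cong (λ b → if b then sign B * a (#Δ B) else 0#) (dec-true (balanced? B) bal)

    weight-unbalanced : ∀ {B} → ¬ Balanced B → weight B ≡ 0#
    weight-unbalanced {B} ¬bal = ≡.cong (λ b → if b then sign B * a (#Δ B) else 0#) (dec-false (balanced? B) ¬bal)

    facetTerm : Subset n → Fin n → Carrier
    facetTerm C t = if lookup C t then weight (erase C t) else 0#

    facetTerm-in : ∀ C t → lookup C t ≡ true → facetTerm C t ≡ weight (erase C t)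
    facetTerm-in C t C∋t = ≡.cong (λ b → if b then weight (erase C t) else 0#) C∋t

    facetTerm-zero : ∀ C t → (lookup C t ≡ true → ¬ Balanced (erase C t)) → facetTerm C t ≈ 0#
    facetTerm-zero C t unbal with lookup C t in C∋t
    ... | false = refl
    ... | true  = reflexive (weight-unbalanced {erase C t} (unbal ≡.refl))

    facetSum-avoiding : ∀ C j₀ → lookup C (x j₀) ≡ false → lookup C (y j₀) ≡ false → facetSum C weight ≈ 0#
    facetSum-avoiding C j₀ C∌x C∌y = sum-zero λ t → facetTerm-zero C t λ _ →
      unbalanced-at {erase C t} j₀ (≡.trans (lookup-erase-false C t C∌y) (≡.sym (lookup-erase-false C t C∌x)))

    -- If C contains both, only C ∖ {x j₀} and C ∖ {y j₀} can be balanced; they are so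
    -- simultaneously and their weights differ by the sign.
    facetSum-containing : ∀ C j₀ → lookup C (x j₀) ≡ true → lookup C (y j₀) ≡ true → facetSum C weight ≈ 0#
    facetSum-containing C j₀ C∋x C∋y = begin
      facetSum C weight                        ≈⟨ sum-pair (facetTerm C) (x≢y j₀ j₀) others ⟩
      facetTerm C (x j₀) + facetTerm C (y j₀)  ≡⟨ ≡.cong₂ _+_ (facetTerm-in C (x j₀) C∋x) (facetTerm-in C (y j₀) C∋y) ⟩
      weight Dx + weight Dy                    ≈⟨ cancel (balanced? Dx) ⟩
      0#                                       ∎
      where
      Dx Dy : Subset n
      Dx = erase C (x j₀)
      Dy = erase C (y j₀)
      y≢x : y j₀ ≢ x j₀
      y≢x = x≢y j₀ j₀ ∘ ≡.sym

      others : ∀ t → t ≢ x j₀ → t ≢ y j₀ → facetTerm C t ≈ 0#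
      others t t≢x t≢y = facetTerm-zero C t λ _ → unbalanced-at {erase C t} j₀
        (≡.trans (lookup-erase-other C t≢y)
          (≡.trans C∋y (≡.sym (≡.trans (lookup-erase-other C t≢x) C∋x))))

      agree : ∀ j → j ≢ j₀ → lookup Dy (x j) ≡ lookup Dx (x j) × lookup Dy (y j) ≡ lookup Dx (y j)
      agree j j≢j₀ =
        ≡.trans (lookup-erase-other C (x≢y j j₀ ∘ ≡.sym)) (≡.sym (lookup-erase-other C (j≢j₀ ∘ ≡.sym ∘ x-inj))) ,
        ≡.trans (lookup-erase-other C (j≢j₀ ∘ ≡.sym ∘ y-inj)) (≡.sym (lookup-erase-other C (x≢y j₀ j)))

      Dx-at-j₀ : lookup Dx (y j₀) ≡ not (lookup Dx (x j₀))
      Dx-at-j₀ = ≡.trans (lookup-erase-other C (x≢y j₀ j₀)) (≡.trans C∋y (≡.cong not (≡.sym (lookup-erase-self C (x j₀)))))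

      Dy-at-j₀ : lookup Dy (y j₀) ≡ not (lookup Dy (x j₀))
      Dy-at-j₀ = ≡.trans (lookup-erase-self C (y j₀)) (≡.cong not (≡.sym (≡.trans (lookup-erase-other C y≢x) C∋x)))

      #X-Dy : #X Dy ≡ suc (#X Dx)
      #X-Dy = ≡.trans (count-erase-miss x C (λ j → x≢y j j₀)) (count-erase-hit x-inj C j₀ C∋x)

      #Δ-Dy : #Δ Dy ≡ #Δ Dx
      #Δ-Dy = ≡.trans (count-erase-miss δ C (λ j → y≢δ j₀ j ∘ ≡.sym))
                      (≡.sym (count-erase-miss δ C (λ j → x≢δ j₀ j ∘ ≡.sym)))

      cancel : Dec (Balanced Dx) → weight Dx + weight Dy ≈ 0#
      cancel (yes balDx) = begin
        weight Dx + weight Dy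
          ≡⟨ ≡.cong₂ _+_ (weight-balanced {Dx} balDx) (weight-balanced {Dy} balDy) ⟩
        sign Dx * a (#Δ Dx) + sign Dy * a (#Δ Dy)
          ≡⟨ ≡.cong₂ (λ m k → sign Dx * a (#Δ Dx) + signPow F m * a k) #X-Dy #Δ-Dy ⟩
        sign Dx * a (#Δ Dx) + ((- 1#) * sign Dx) * a (#Δ Dx)
          ≈⟨ sign-cancel (sign Dx) (a (#Δ Dx)) ⟩
        0# ∎
        where
        balDy : Balanced Dy
        balDy = balance-transfer {Dx} {Dy} j₀ agree Dy-at-j₀ balDx
      cancel (no ¬balDx) = begin
        weight Dx + weight Dy  ≡⟨ ≡.cong₂ _+_ (weight-unbalanced {Dx} ¬balDx) (weight-unbalanced {Dy} ¬balDy) ⟩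
        0# + 0#                ≈⟨ +-identityˡ 0# ⟩
        0#                     ∎
        where
        ¬balDy : ¬ Balanced Dy
        ¬balDy balDy = ¬balDx (balance-transfer {Dy} {Dx} j₀
          (λ j j≢j₀ → let same-x , same-y = agree j j≢j₀ in ≡.sym same-x , ≡.sym same-y) Dx-at-j₀ balDy)

    facetSum-unbalanced : ∀ C → ¬ Balanced C → facetSum C weight ≈ 0#
    facetSum-unbalanced C ¬bal with unbalanced-pair {C} ¬bal
    ... | j₀ , same with lookup C (x j₀) in C∋x
    ...   | false = facetSum-avoiding C j₀ C∋x same
    ...   | true  = facetSum-containing C j₀ C∋x same

    -- In a balanced row only the facets erasing a point of Δ or of R survive:
    -- the value is J (-1)^{|C∩X|} a(J-1) + r (-1)^{|C∩X|} a(J), J = |C ∩ Δ|, r = |C ∩ R|.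
    facetSum-balanced : ∀ C → Balanced C →
      facetSum C weight ≈ #Δ C ×ᵣ (sign C * a (#Δ C ∸ 1)) + #R C ×ᵣ (sign C * a (#Δ C))
    facetSum-balanced C bal = begin
      facetSum C weight
        ≈⟨ partitionF (facetTerm C) ⟩
      ((sum (facetTerm C ∘ x) + sum (facetTerm C ∘ y)) + sum (facetTerm C ∘ δ))
        + sum (λ t → if rest t then facetTerm C t else 0#)
        ≈⟨ +-cong (+-cong (+-cong X-facets Y-facets) (sum-cong-≋ Δ-facet)) (sum-cong-≋ R-facet) ⟩
      ((0# + 0#) + sum (λ j → if lookup C (δ j) then c₁ else 0#))
        + sum (λ t → if rest t ∧ lookup C t then c₂ else 0#)
        ≈⟨ +-congʳ (trans (+-congʳ (+-identityˡ 0#)) (+-identityˡ _)) ⟩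
      sum (λ j → if lookup C (δ j) then c₁ else 0#) + sum (λ t → if rest t ∧ lookup C t then c₂ else 0#)
        ≈⟨ +-cong (sum-select (lookup C ∘ δ) c₁) (sum-select (λ t → rest t ∧ lookup C t) c₂) ⟩
      #Δ C ×ᵣ c₁ + #R C ×ᵣ c₂ ∎
      where
      c₁ c₂ : Carrier
      c₁ = sign C * a (#Δ C ∸ 1)
      c₂ = sign C * a (#Δ C)

      X-facets : sum (facetTerm C ∘ x) ≈ 0#
      X-facets = sum-zero λ j → facetTerm-zero C (x j) (erase-x-unbalances {C} bal j)

      Y-facets : sum (facetTerm C ∘ y) ≈ 0#
      Y-facets = sum-zero λ j → facetTerm-zero C (y j) (erase-y-unbalances {C} bal j)

      Δ-facet : ∀ j → facetTerm C (δ j) ≈ (if lookup C (δ j) then c₁ else 0#)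
      Δ-facet j with lookup C (δ j) in C∋δj
      ... | false = refl
      ... | true  = reflexive (≡.trans (weight-balanced {erase C (δ j)} (erase-keeps-balance {C} bal ∉X ∉Y))
                      (≡.cong₂ (λ m k → signPow F m * a k) (count-erase-miss x C ∉X)
                        (≡.cong (_∸ 1) (≡.sym (count-erase-hit δ-inj C j C∋δj)))))
        where
        ∉X : ∀ j′ → x j′ ≢ δ j
        ∉X j′ = x≢δ j′ j
        ∉Y : ∀ j′ → y j′ ≢ δ j
        ∉Y j′ = y≢δ j′ j

      R-facet : ∀ t → (if rest t then facetTerm C t else 0#) ≈ (if rest t ∧ lookup C t then c₂ else 0#)
      R-facet t with rest t in rest-t
      ... | false = refl
      ... | true  with rest⁻ rest-t | lookup C t
      ...   | _               | false = refl
      ...   | ∉X , ∉Y , ∉Δ   | true  =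
        reflexive (≡.trans (weight-balanced {erase C t} (erase-keeps-balance {C} bal ∉X ∉Y))
          (≡.cong₂ (λ m k → signPow F m * a k) (count-erase-miss x C ∉X) (count-erase-miss δ C ∉Δ)))

    module _ (a-inv : ∀ j → j < d → suc j ×ᵣ a j ≈ 1#) (char : suc d ×ᵣ 1# ≈ 0#)
             (size : n ℕ.+ 1 ≡ (i ℕ.+ d) ℕ.+ (i ℕ.+ d)) where

      open Reciprocals d a a-inv char

      -- On a balanced row, v takes the value computed in facetSum-balanced: for r = 0 the set
      -- is some X_τ ∪ (Y ∖ Y_τ) ∪ Δ, for r > 0 it is no such set and the value vanishes.
      balanced-row : ∀ C → Balanced C → ∣ C ∣ ≡ i ℕ.+ d →
        vVec F x y δ C ≈ #Δ C ×ᵣ (sign C * a (#Δ C ∸ 1)) + #R C ×ᵣ (sign C * a (#Δ C))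
      balanced-row C bal ∣C∣≡i+d with #R C in #R≡ | balanced-#Δ+#R {C} bal ∣C∣≡i+d
      ... | zero | J+0≡d = begin
        vVec F x y δ C                                       ≈⟨ vVec-config C τ (config-complete C bal #R≡ #Δ≡d) ⟩
        sign C                                               ≈⟨ *-identityʳ (sign C) ⟨
        sign C * 1#                                          ≈⟨ *-congˡ (trans (+-identityʳ _) full-row′) ⟨
        sign C * (#Δ C ×ᵣ a (#Δ C ∸ 1) + 0 ×ᵣ a (#Δ C))     ≈⟨ ×-factor (#Δ C) 0 (sign C) (a (#Δ C ∸ 1)) (a (#Δ C)) ⟨
        #Δ C ×ᵣ (sign C * a (#Δ C ∸ 1)) + 0 ×ᵣ (sign C * a (#Δ C)) ∎
        where
        #Δ≡d : #Δ C ≡ d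
        #Δ≡d = ≡.trans (≡.sym (ℕP.+-identityʳ (#Δ C))) J+0≡d
        τ : Subset i
        τ = tabulate (lookup C ∘ x)
        full-row′ : #Δ C ×ᵣ a (#Δ C ∸ 1) ≈ 1#
        full-row′ = trans (reflexive (≡.cong (λ m → m ×ᵣ a (m ∸ 1)) #Δ≡d)) (full-row (≡.sym (rest-size size)))
      ... | suc r | J+r≡d = begin
        vVec F x y δ C                                       ≈⟨ vVec-other C not-config ⟩
        0#                                                   ≈⟨ zeroʳ (sign C) ⟨
        sign C * 0#                                          ≈⟨ *-congˡ (vanishing-row (#Δ C) r J+r≡d 1≤J) ⟨
        sign C * (#Δ C ×ᵣ a (#Δ C ∸ 1) + suc r ×ᵣ a (#Δ C)) ≈⟨ ×-factor (#Δ C) (suc r) (sign C) (a (#Δ C ∸ 1)) (a (#Δ C)) ⟨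
        #Δ C ×ᵣ (sign C * a (#Δ C ∸ 1)) + suc r ×ᵣ (sign C * a (#Δ C)) ∎
        where
        not-config : ∀ τ → C ≢ config τ
        not-config τ C≡τ = contradiction (≡.trans (≡.sym #R≡) (≡.trans (≡.cong #R C≡τ) (#R-config τ))) λ ()
        1≤J : 1 ≤ #Δ C
        1≤J = meets-Δ C (≡.trans (≡.cong (#Δ C ℕ.+_) #R≡) J+r≡d) (rest-size size)

      -- Unbalanced rows vanish on both sides, since the sets X_τ ∪ (Y ∖ Y_τ) ∪ Δ are balanced.
      row : ∀ C → ∣ C ∣ ≡ i ℕ.+ d → vVec F x y δ C ≈ facetSum C weight
      row C ∣C∣≡i+d with balanced? C
      ... | yes bal = trans (balanced-row C bal ∣C∣≡i+d) (sym (facetSum-balanced C bal))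
      ... | no ¬bal = trans (vVec-other C not-config) (sym (facetSum-unbalanced C ¬bal))
        where
        not-config : ∀ τ → C ≢ config τ
        not-config τ ≡.refl = ¬bal (config-balanced τ)

      in-column-space : ∀ A s → A ≡ i ℕ.+ d → suc s ≡ A → InColumnSpace F n A s (vVec F x y δ)
      in-column-space A s A≡i+d 1+s≡A = weight , λ C ∣C∣≡A →
        trans (row C (≡.trans ∣C∣≡A A≡i+d)) (sym (inclusion-row C s weight (≡.trans ∣C∣≡A (≡.sym 1+s≡A))))

reciprocals : ∀ {c ℓ} (F : CommutativeRing c ℓ) → IsField F → ∀ p → HasCharacteristic F p →
  let open CommutativeRing F; open Multiples F in
  ∃ λ (a : ℕ → Carrier) → ∀ j → suc j < p → suc j ×ᵣ a j ≈ 1#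
reciprocals F (_ , inverse) p (_ , nonzero) = reciprocal , reciprocal-inv
  where
  open CommutativeRing F
  open Multiples F

  invert : ∀ {j} → suc j < p → ∃ λ b → (_·1 F (suc j)) * b ≈ 1#
  invert {j} 1+j<p = inverse (_·1 F (suc j)) (nonzero (suc j) (s≤s z≤n) 1+j<p)

  reciprocal : ℕ → Carrier
  reciprocal j with suc j ℕP.<? p
  ... | yes 1+j<p = proj₁ (invert 1+j<p)
  ... | no _      = 0#

  reciprocal-inv : ∀ j → suc j < p → suc j ×ᵣ reciprocal j ≈ 1#
  reciprocal-inv j 1+j<p with suc j ℕP.<? p
  ... | yes 1+j<p′ = trans (sym (×1-* (suc j) _))
                       (trans (*-congʳ (reflexive (≡.sym (·1≡×1 (suc j))))) (proj₂ (invert 1+j<p′)))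
  ... | no 1+j≮p   = contradiction 1+j<p 1+j≮p

open import Data.Nat using (_*_)

-- Arithmetic of the parameters.  For p = 0 the sets X ∪ Y alone do not fit into 2k - 3 points;
-- for p = q + 2 and k = p + 1 + o one has i = o + 1 and d = q + 1.
private
  too-small : ∀ k → 0 < k → 2 * k ∸ 3 < k ℕ.+ k
  too-small (suc m) _ = ℕP.≤-trans (s≤s (ℕP.∸-monoʳ-≤ (2 * suc m) (s≤s (z≤n {2}))))
                                   (ℕP.≤-reflexive (≡.cong (suc m ℕ.+_) (ℕP.+-identityʳ (suc m))))

  i-value : ∀ q o → suc (suc (suc q)) ℕ.+ o ∸ suc (suc q) ≡ suc o
  i-value q o = ≡.trans (≡.cong (_∸ q) (≡.sym (ℕP.+-suc q o))) (ℕP.m+n∸m≡n q (suc o))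

  d-value : ∀ q o → let k = suc (suc (suc q)) ℕ.+ o in (k ∸ 1) ∸ (k ∸ suc (suc q)) ≡ suc q
  d-value q o = ≡.trans (≡.cong (suc (suc (q ℕ.+ o)) ∸_) (i-value q o)) (ℕP.m+n∸n≡m (suc q) o)

  i+d-value : ∀ q o → suc o ℕ.+ suc q ≡ suc (suc (q ℕ.+ o))
  i+d-value = solve-∀

  ground-size : ∀ q o → (q ℕ.+ o) ℕ.+ suc (suc (suc (q ℕ.+ o ℕ.+ 0))) ℕ.+ 1 ≡
                        suc (suc (q ℕ.+ o)) ℕ.+ suc (suc (q ℕ.+ o))
  ground-size = solve-∀

lemma7p3 : ∀ {c ℓ} (F : CommutativeRing c ℓ) → IsField F → IsFinite F →
    (p : ℕ) → HasCharacteristic F p → (k : ℕ) → p < k →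
    (x y : Fin (k ∸ p) → Fin (2 * k ∸ 3)) →
    (δ : Fin ((k ∸ 1) ∸ (k ∸ p)) → Fin (2 * k ∸ 3)) →
    Injective _≡_ _≡_ x → Injective _≡_ _≡_ y → Injective _≡_ _≡_ δ →
    (∀ a b → x a ≢ y b) → (∀ a b → x a ≢ δ b) → (∀ a b → y a ≢ δ b) →
    InColumnSpace F (2 * k ∸ 3) (k ∸ 1) (k ∸ 2) (vVec F x y δ)
-- p = 0: X and Y would need 2k points.
lemma7p3 F _ _ zero _ k 0<k x y δ x-inj y-inj δ-inj x≢y x≢δ y≢δ =
  contradiction (ℕP.≤-trans (ℕP.m≤m+n (k ℕ.+ k) _) (ℕP.≤-trans (ℕP.m≤m+n _ _) (ℕP.≤-reflexive (≡.sym size-split))))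
                (ℕP.<⇒≱ (too-small k 0<k))
  where open Configuration x y δ x-inj y-inj δ-inj x≢y x≢δ y≢δ
-- p = 1: no field has characteristic 1.
lemma7p3 F (1≉0 , _) _ (suc zero) (1≈0 , _) _ _ _ _ _ _ _ _ _ _ _ =
  contradiction (trans (sym (+-identityʳ 1#)) 1≈0) 1≉0
  where open CommutativeRing F
-- p ≥ 2: d = p - 1, the reciprocals of 1, …, d exist, and d + 1 = p vanishes.
lemma7p3 F isField _ p@(suc (suc q)) char k p<k x y δ x-inj y-inj δ-inj x≢y x≢δ y≢δ
  with ℕP.m≤n⇒∃[o]m+o≡n p<k
... | o , ≡.refl = in-column-space a-inv char′ size (k ∸ 1) (k ∸ 2) (≡.sym i+d≡k-1) ≡.refl
  where
  open CommutativeRing F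
  open Multiples F
  open Configuration x y δ x-inj y-inj δ-inj x≢y x≢δ y≢δ
  a : ℕ → Carrier
  a = proj₁ (reciprocals F isField p char)
  d≡1+q : (k ∸ 1) ∸ (k ∸ p) ≡ suc q
  d≡1+q = d-value q o
  a-inv : ∀ j → j < (k ∸ 1) ∸ (k ∸ p) → suc j ×ᵣ a j ≈ 1#
  a-inv j j<d = proj₂ (reciprocals F isField p char) j (s≤s (ℕP.≤-trans j<d (ℕP.≤-reflexive d≡1+q)))
  char′ : suc ((k ∸ 1) ∸ (k ∸ p)) ×ᵣ 1# ≈ 0#
  char′ = trans (reflexive (≡.trans (≡.cong (λ m → suc m ×ᵣ 1#) d≡1+q) (≡.sym (·1≡×1 p)))) (proj₁ char)
  i+d≡k-1 : (k ∸ p) ℕ.+ ((k ∸ 1) ∸ (k ∸ p)) ≡ k ∸ 1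
  i+d≡k-1 = ≡.trans (≡.cong₂ ℕ._+_ (i-value q o) d≡1+q) (i+d-value q o)
  size : 2 ℕ.* k ∸ 3 ℕ.+ 1 ≡ ((k ∸ p) ℕ.+ ((k ∸ 1) ∸ (k ∸ p))) ℕ.+ ((k ∸ p) ℕ.+ ((k ∸ 1) ∸ (k ∸ p)))
  size = ≡.trans (ground-size q o) (≡.sym (≡.cong₂ ℕ._+_ i+d≡k-1 i+d≡k-1))
  open ColumnSpace F a
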